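{- Let $G$ be a strongly-regular graph with parameters $(n,k,a,c)$. Let $D$ be the distance matrix of $G$ and $A$ the adjacency matrix of $G$. Then $D$ is invertible if and only if $$k+c\neq 2a+4,$$ and when $D$ is invertible its inverse is $$D^{ -1}=\frac{(2+a-c)I-A}{k+c-2a-4}+\frac{c\,(2k+c-2a-4)}{k\,(k+c-2a-4)\,(2k+c-2a-2)}\,J,$$ where $I$ is the $n\times n$ identity matrix and $J$ is the $n\times n$ all-ones matrix.
   Context: A graph $G$ that is regular but neither complete nor empty is strongly-regular with parameters $(n,k,a,c)$ if it has $n$ vertices, is $k$-regular, every pair of adjacent vertices has exactly $a$ common neighbours, and every pair of distinct non-adjacent vertices has exactly $c$ common neighbours. The distance matrix $D$ of a connected graph has $(u,v)$-entry equal to the graph distance (length of a shortest path) between $u$ and $v$. -}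

module Defs where

open import Data.Nat as ℕ using (ℕ; zero; suc; _<_)
open import Data.Integer using (+_)
open import Data.Fin using (Fin)
import Data.Fin as Fin
open import Data.Bool using (Bool; true; false; if_then_else_; _∧_)
open import Data.Product using (Σ; _×_; ∃; ∃-syntax)
open import Data.Rational as ℚ using (ℚ; 0ℚ; 1ℚ; _+_; _*_; _-_; ≢-nonZero)
open import Data.Rational.Properties using (_≟_)
open import Relation.Nullary using (¬_; yes; no)
open import Relation.Binary.PropositionalEquality using (_≡_; _≢_)

record Graph (n : ℕ) : Set where
  field
    adj   : Fin n → Fin n → Bool
    sym   : ∀ u v → adj u v ≡ adj v u
    irref : ∀ u → adj u u ≡ false

open Graph public

Adj : ∀ {n} → Graph n → Fin n → Fin n → Set
Adj G u v = adj G u v ≡ true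

count : ∀ {n} → (Fin n → Bool) → ℕ
count {zero}  p = 0
count {suc n} p = (if p Fin.zero then 1 else 0) ℕ.+ count (λ i → p (Fin.suc i))

degree : ∀ {n} → Graph n → Fin n → ℕ
degree G u = count (adj G u)

commonNeighbours : ∀ {n} → Graph n → Fin n → Fin n → ℕ
commonNeighbours G u v = count (λ w → adj G u w ∧ adj G v w)

record IsStronglyRegular {n : ℕ} (G : Graph n) (k a c : ℕ) : Set where
  field
    notEmpty    : ∃[ u ] ∃[ v ] Adj G u v
    notComplete : ∃[ u ] ∃[ v ] (u ≢ v × ¬ Adj G u v)
    regular     : ∀ u → degree G u ≡ k
    adjCommon   : ∀ u v → Adj G u v → commonNeighbours G u v ≡ a
    nonAdjCommon : ∀ u v → u ≢ v → ¬ Adj G u v → commonNeighbours G u v ≡ c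

Walk : ∀ {n} → Graph n → ℕ → Fin n → Fin n → Set
Walk G zero    u v = u ≡ v
Walk G (suc m) u v = ∃[ w ] (Adj G u w × Walk G m w v)

IsDistance : ∀ {n} → Graph n → Fin n → Fin n → ℕ → Set
IsDistance G u v d = Walk G d u v × (∀ m → m < d → ¬ Walk G m u v)

Mat : ℕ → Set
Mat n = Fin n → Fin n → ℚ

fromℕ : ℕ → ℚ
fromℕ m = + m ℚ./ 1

sumFin : ∀ {n} → (Fin n → ℚ) → ℚ
sumFin {zero}  f = 0ℚ
sumFin {suc n} f = f Fin.zero + sumFin (λ i → f (Fin.suc i))

_⊗_ : ∀ {n} → Mat n → Mat n → Mat n
(M ⊗ N) i j = sumFin (λ l → M i l * N l j)

I : ∀ {n} → Mat n
I i j with i Fin.≟ j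
... | yes _ = 1ℚ
... | no  _ = 0ℚ

J : ∀ {n} → Mat n
J i j = 1ℚ

_≋_ : ∀ {n} → Mat n → Mat n → Set
M ≋ N = ∀ i j → M i j ≡ N i j

IsInverse : ∀ {n} → Mat n → Mat n → Set
IsInverse M N = (M ⊗ N) ≋ I × (N ⊗ M) ≋ I

Invertible : ∀ {n} → Mat n → Set
Invertible {n} M = Σ (Mat n) (IsInverse M)

adjMatrix : ∀ {n} → Graph n → Mat n
adjMatrix G i j = if adj G i j then 1ℚ else 0ℚ

toℚMat : ∀ {n} → (Fin n → Fin n → ℕ) → Mat n
toℚMat D i j = fromℕ (D i j)

-- total division on ℚ (x / 0 = 0); only used with nonzero denominators
_÷_ : ℚ → ℚ → ℚ
x ÷ y with y ≟ 0ℚ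
... | yes _ = 0ℚ
... | no y≢0 = ℚ._÷_ x y {{≢-nonZero y≢0}}

claimedInverse : ∀ {n} → Graph n → ℕ → ℕ → ℕ → Mat n
claimedInverse G k a c i j =
  (((q 2 + A' - C') * I i j - adjMatrix G i j) ÷ δ)
  + ((C' * (q 2 * K + C' - q 2 * A' - q 4)) ÷ (K * δ * (q 2 * K + C' - q 2 * A' - q 2))) * J i j
  where
    q : ℕ → ℚ
    q = fromℕ
    K = fromℕ k
    A' = fromℕ a
    C' = fromℕ c
    δ = K + C' - q 2 * A' - q 4

module Submission where

-- Since c ≥ 1 the graph has diameter 2, so its distance matrix is D = 2J − 2I − A. The identities
-- A² = kI + aA + c(J − I − A) and AJ = JA = kJ make the matrices pI + qA + rJ a commutative algebra
-- with explicit structure constants, in which the counting identity k(k − a − 1) = c(n − k − 1)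
-- follows from (AA)J = A(AJ). Write δ = k + c − 2a − 4 and σ = 2 + a − c. The product
-- D(pI + qA + rJ) has no A-term exactly when p = −σq, and then its I-coefficient is −δq.
-- If δ ≠ 0 this yields the claimed inverse, whose J-coefficient relies on
-- c(2n − 2 − k) = k(2k + c − 2a − 2), a rearrangement of the counting identity.
-- If δ = 0, D annihilates ν(A − σI) + (2σ + c − 2k)J with ν = 2n − 2 − k > 0, a nonzero matrix,
-- so D has no left inverse.

open import Defs hiding (sym)
open import Data.Nat using (ℕ)
open import Data.Fin using (Fin)
import Data.Fin as Fin
open import Data.Product using (_×_; _,_; ∃-syntax)
open import Function using (_∘_)
open import Function.Bundles using (_⇔_; mk⇔)
open import Relation.Binary.PropositionalEquality using (_≡_; _≢_; refl; sym; trans; cong; cong₂; module ≡-Reasoning)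
open import Relation.Nullary using (¬_; Dec; yes; no; contradiction)

module RationalArithmetic where

  open import Level using (0ℓ)
  open import Data.Nat using (zero; suc)
  import Data.Nat as ℕ
  import Data.Integer as ℤ
  import Data.Integer.Properties as ℤ
  open import Data.Maybe.Base as Maybe using ()
  open import Data.Rational using (ℚ; 0ℚ; 1ℚ; _+_; _*_; 1/_; toℚᵘ; ≢-nonZero)
  import Data.Rational.Unnormalised as ℚᵘ
  import Data.Rational.Unnormalised.Properties as ℚᵘ
  open import Data.Rational.Properties
    using (_≟_; +-*-commutativeRing; fromℚᵘ-cong; fromℚᵘ-injective; fromℚᵘ-toℚᵘ; toℚᵘ-fromℚᵘ; toℚᵘ-homo-+; *-inverseˡ; *-assoc; *-identityˡ; *-zeroʳ)
  open import Algebra.Bundles using (CommutativeRing)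
  open import Algebra.Properties.Semiring.Mult (CommutativeRing.semiring +-*-commutativeRing)
    using (×-homo-+; ×1-homo-*) renaming (_×_ to _×ℚ_)
  open import Relation.Nullary.Decidable.Core using (dec⇒maybe)
  open import Tactic.RingSolver.Core.AlmostCommutativeRing using (AlmostCommutativeRing; fromCommutativeRing)

  ℚ-ring : AlmostCommutativeRing 0ℓ 0ℓ
  ℚ-ring = fromCommutativeRing +-*-commutativeRing (λ x → Maybe.map sym (dec⇒maybe (x ≟ 0ℚ)))

  fromℕ-suc : ∀ m → fromℕ (suc m) ≡ 1ℚ + fromℕ m
  fromℕ-suc m = trans (fromℚᵘ-cong (ℚᵘ.≃-sym toℚᵘ[1+m]≃1+m)) (fromℚᵘ-toℚᵘ (1ℚ + fromℕ m))
    where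
    1+m≃suc-m : ℚᵘ.1ℚᵘ ℚᵘ.+ ℚᵘ.mkℚᵘ (ℤ.+ m) 0 ℚᵘ.≃ ℚᵘ.mkℚᵘ (ℤ.+ suc m) 0
    1+m≃suc-m = ℚᵘ.*≡* (trans (ℤ.*-identityʳ _) (trans (cong (λ x → ℤ.1ℤ ℤ.+ x) (ℤ.*-identityʳ (ℤ.+ m))) (sym (ℤ.*-identityʳ _))))
    toℚᵘ[1+m]≃1+m : toℚᵘ (1ℚ + fromℕ m) ℚᵘ.≃ ℚᵘ.mkℚᵘ (ℤ.+ suc m) 0
    toℚᵘ[1+m]≃1+m = ℚᵘ.≃-trans (toℚᵘ-homo-+ 1ℚ (fromℕ m))
      (ℚᵘ.≃-trans (ℚᵘ.+-congʳ ℚᵘ.1ℚᵘ (toℚᵘ-fromℚᵘ (ℚᵘ.mkℚᵘ (ℤ.+ m) 0))) 1+m≃suc-m)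

  fromℕ≡×1 : ∀ m → fromℕ m ≡ m ×ℚ 1ℚ
  fromℕ≡×1 zero    = refl
  fromℕ≡×1 (suc m) = trans (fromℕ-suc m) (cong (1ℚ +_) (fromℕ≡×1 m))

  fromℕ-+ : ∀ m n → fromℕ (m ℕ.+ n) ≡ fromℕ m + fromℕ n
  fromℕ-+ m n = trans (fromℕ≡×1 (m ℕ.+ n))
    (trans (×-homo-+ 1ℚ m n) (sym (cong₂ _+_ (fromℕ≡×1 m) (fromℕ≡×1 n))))

  fromℕ-* : ∀ m n → fromℕ (m ℕ.* n) ≡ fromℕ m * fromℕ n
  fromℕ-* m n = trans (fromℕ≡×1 (m ℕ.* n))
    (trans (×1-homo-* m n) (sym (cong₂ _*_ (fromℕ≡×1 m) (fromℕ≡×1 n))))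

  fromℕ-injective : ∀ {m n} → fromℕ m ≡ fromℕ n → m ≡ n
  fromℕ-injective {m} {n} eq with fromℚᵘ-injective {ℚᵘ.mkℚᵘ (ℤ.+ m) 0} {ℚᵘ.mkℚᵘ (ℤ.+ n) 0} eq
  ... | ℚᵘ.*≡* m*1≡n*1 = ℤ.+-injective (trans (sym (ℤ.*-identityʳ (ℤ.+ m))) (trans m*1≡n*1 (ℤ.*-identityʳ (ℤ.+ n))))

  *-≢0 : ∀ {x y} → x ≢ 0ℚ → y ≢ 0ℚ → x * y ≢ 0ℚ
  *-≢0 {x} {y} x≢0 y≢0 xy≡0 = y≢0 (begin
    y                ≡⟨ sym (*-identityˡ y) ⟩
    1ℚ * y           ≡⟨ cong (_* y) (sym (*-inverseˡ x)) ⟩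
    (1/ x * x) * y   ≡⟨ *-assoc (1/ x) x y ⟩
    1/ x * (x * y)   ≡⟨ cong (1/ x *_) xy≡0 ⟩
    1/ x * 0ℚ        ≡⟨ *-zeroʳ (1/ x) ⟩
    0ℚ               ∎)
    where
    open ≡-Reasoning
    instance _ = ≢-nonZero x≢0

  ÷-≡-*1/ : ∀ x {y} (y≢0 : y ≢ 0ℚ) → x ÷ y ≡ x * 1/_ y {{≢-nonZero y≢0}}
  ÷-≡-*1/ x {y} y≢0 with y ≟ 0ℚ
  ... | yes y≡0 = contradiction y≡0 y≢0
  ... | no _    = refl

  linear-cong : ∀ x y z {u u′ v v′ w w′ : ℚ} → u ≡ u′ → v ≡ v′ → w ≡ w′ → x * u + y * v + z * w ≡ x * u′ + y * v′ + z * w′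
  linear-cong x y z u≡ v≡ w≡ = cong₂ _+_ (cong₂ _+_ (cong (x *_) u≡) (cong (y *_) v≡)) (cong (z *_) w≡)

module FiniteSums where

  open import Data.Nat using (zero; suc)
  import Data.Nat as ℕ
  open import Data.Bool using (Bool; true; false; if_then_else_; _∧_)
  open import Data.Rational using (ℚ; 0ℚ; 1ℚ; _+_; _*_)
  open import Data.Rational.Properties using (+-*-commutativeRing; *-identityˡ; *-zeroˡ; +-identityˡ)
  open import Algebra.Bundles using (CommutativeRing)
  open import Algebra.Properties.Semiring.Sum (CommutativeRing.semiring +-*-commutativeRing)
    using (sum; sum-cong-≗; ∑-distrib-+; ∑-comm; sum-replicate-zero; *-distribˡ-sum; *-distribʳ-sum)
  open RationalArithmetic

  sumFin≡sum : ∀ {n} (f : Fin n → ℚ) → sumFin f ≡ sum f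
  sumFin≡sum {zero}  f = refl
  sumFin≡sum {suc n} f = cong (f Fin.zero +_) (sumFin≡sum (λ i → f (Fin.suc i)))

  sumFin-cong : ∀ {n} {f g : Fin n → ℚ} → (∀ i → f i ≡ g i) → sumFin f ≡ sumFin g
  sumFin-cong {f = f} {g} f≗g = trans (sumFin≡sum f) (trans (sum-cong-≗ {x = f} {g} f≗g) (sym (sumFin≡sum g)))

  sumFin-*ˡ : ∀ {n} x (f : Fin n → ℚ) → sumFin (λ i → x * f i) ≡ x * sumFin f
  sumFin-*ˡ x f = trans (sumFin≡sum (λ i → x * f i)) (trans (sym (*-distribˡ-sum x f)) (cong (x *_) (sym (sumFin≡sum f))))

  sumFin-*ʳ : ∀ {n} x (f : Fin n → ℚ) → sumFin (λ i → f i * x) ≡ sumFin f * x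
  sumFin-*ʳ x f = trans (sumFin≡sum (λ i → f i * x)) (trans (sym (*-distribʳ-sum x f)) (cong (_* x) (sym (sumFin≡sum f))))

  sumFin-+ : ∀ {n} (f g : Fin n → ℚ) → sumFin (λ i → f i + g i) ≡ sumFin f + sumFin g
  sumFin-+ f g = trans (sumFin≡sum (λ i → f i + g i)) (trans (∑-distrib-+ f g) (sym (cong₂ _+_ (sumFin≡sum f) (sumFin≡sum g))))

  sumFin-linear₃ : ∀ {n} x y z (f g h : Fin n → ℚ) →
    sumFin (λ i → x * f i + y * g i + z * h i) ≡ x * sumFin f + y * sumFin g + z * sumFin h
  sumFin-linear₃ x y z f g h = trans (sumFin-+ (λ i → x * f i + y * g i) (λ i → z * h i))
    (cong₂ _+_ (trans (sumFin-+ (λ i → x * f i) (λ i → y * g i)) (cong₂ _+_ (sumFin-*ˡ x f) (sumFin-*ˡ y g))) (sumFin-*ˡ z h))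

  sumFin-comm : ∀ {m n} (f : Fin m → Fin n → ℚ) →
    sumFin (λ i → sumFin (λ j → f i j)) ≡ sumFin (λ j → sumFin (λ i → f i j))
  sumFin-comm f = begin
    sumFin (λ i → sumFin (f i))          ≡⟨ sumFin-cong (λ i → sumFin≡sum (f i)) ⟩
    sumFin (λ i → sum (f i))             ≡⟨ sumFin≡sum (λ i → sum (f i)) ⟩
    sum (λ i → sum (f i))                ≡⟨ ∑-comm f ⟩
    sum (λ j → sum (λ i → f i j))        ≡⟨ sumFin≡sum (λ j → sum (λ i → f i j)) ⟨
    sumFin (λ j → sum (λ i → f i j))     ≡⟨ sumFin-cong (λ j → sumFin≡sum (λ i → f i j)) ⟨
    sumFin (λ j → sumFin (λ i → f i j))  ∎
    where open ≡-Reasoning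

  sumFin-zero : ∀ {n} → sumFin {n} (λ _ → 0ℚ) ≡ 0ℚ
  sumFin-zero {n} = trans (sumFin≡sum {n} (λ _ → 0ℚ)) (sum-replicate-zero n)

  sumFin-one : ∀ {n} → sumFin {n} (λ _ → 1ℚ) ≡ fromℕ n
  sumFin-one {zero}  = refl
  sumFin-one {suc n} = trans (cong (1ℚ +_) (sumFin-one {n})) (sym (fromℕ-suc n))

  indicator : Bool → ℚ
  indicator b = if b then 1ℚ else 0ℚ

  sumFin-indicator : ∀ {n} (p : Fin n → Bool) → sumFin (λ i → indicator (p i)) ≡ fromℕ (count p)
  sumFin-indicator {zero}  p = refl
  sumFin-indicator {suc n} p with p Fin.zero
  ... | true  = trans (cong (1ℚ +_) (sumFin-indicator (λ i → p (Fin.suc i)))) (sym (fromℕ-suc (count (λ i → p (Fin.suc i)))))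
  ... | false = trans (+-identityˡ _) (sumFin-indicator (λ i → p (Fin.suc i)))

  indicator-∧ : ∀ x y → indicator (x ∧ y) ≡ indicator x * indicator y
  indicator-∧ true  y = sym (*-identityˡ (indicator y))
  indicator-∧ false y = sym (*-zeroˡ (indicator y))

  count-cong : ∀ {n} {p q : Fin n → Bool} → (∀ i → p i ≡ q i) → count p ≡ count q
  count-cong {zero}  p≗q = refl
  count-cong {suc n} p≗q = cong₂ (λ b m → (if b then 1 else 0) ℕ.+ m) (p≗q Fin.zero) (count-cong (λ i → p≗q (Fin.suc i)))

  ∧≡true : ∀ {x y} → (x ∧ y) ≡ true → x ≡ true × y ≡ true
  ∧≡true {true} {true} _ = refl , refl

  count≢0 : ∀ {n} (p : Fin n → Bool) {w} → p w ≡ true → count p ≢ 0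
  count≢0 p {Fin.zero} pw≡true with p Fin.zero
  count≢0 p {Fin.zero} refl | true = λ ()
  count≢0 p {Fin.suc w} pw≡true with p Fin.zero
  ... | true  = λ ()
  ... | false = count≢0 (λ i → p (Fin.suc i)) pw≡true

  count≢0⇒∃ : ∀ {n} (p : Fin n → Bool) → count p ≢ 0 → ∃[ w ] p w ≡ true
  count≢0⇒∃ {zero}  p count≢0 = contradiction refl count≢0
  count≢0⇒∃ {suc n} p count≢0 with p Fin.zero in p0
  ... | true  = Fin.zero , p0
  ... | false with count≢0⇒∃ (λ i → p (Fin.suc i)) count≢0
  ...   | w , pw = Fin.suc w , pw

module Matrices where

  open import Level using (0ℓ)
  open import Data.Nat using (suc)
  open import Data.Fin.Properties using (punchInᵢ≢i)
  open import Data.Rational using (ℚ; 0ℚ; 1ℚ; _+_; _*_)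
  open import Data.Rational.Properties using (+-*-commutativeRing; *-identityˡ; *-identityʳ; *-zeroˡ; *-zeroʳ; +-identityʳ; *-comm; *-assoc)
  open import Algebra.Bundles using (CommutativeRing)
  open import Algebra.Properties.Semiring.Sum (CommutativeRing.semiring +-*-commutativeRing)
    using (sum; sum-cong-≗; sum-replicate-zero; sum-remove)
  open import Relation.Binary.Bundles using (Setoid)
  import Relation.Binary.Reasoning.Setoid
  open import Tactic.RingSolver using (solve-∀)
  open RationalArithmetic
  open FiniteSums

  I-diag : ∀ {n} (i : Fin n) → I i i ≡ 1ℚ
  I-diag i with i Fin.≟ i
  ... | yes _   = refl
  ... | no i≢i = contradiction refl i≢i

  I-≢ : ∀ {n} {i j : Fin n} → i ≢ j → I i j ≡ 0ℚ
  I-≢ {i = i} {j} i≢j with i Fin.≟ j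
  ... | yes i≡j = contradiction i≡j i≢j
  ... | no _    = refl

  I-sym : ∀ {n} (i j : Fin n) → I i j ≡ I j i
  I-sym i j = by-cases (i Fin.≟ j)
    where
    by-cases : Dec (i ≡ j) → I i j ≡ I j i
    by-cases (yes refl) = refl
    by-cases (no i≢j)   = trans (I-≢ i≢j) (sym (I-≢ (λ j≡i → i≢j (sym j≡i))))

  sumFin-δ : ∀ {n} (i : Fin n) (f : Fin n → ℚ) → sumFin (λ l → I i l * f l) ≡ f i
  sumFin-δ {suc n} i f = begin
    sumFin (λ l → I i l * f l)
      ≡⟨ trans (sumFin≡sum (λ l → I i l * f l)) (sum-remove {i = i} (λ l → I i l * f l)) ⟩
    I i i * f i + sum (λ l → I i (Fin.punchIn i l) * f (Fin.punchIn i l))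
      ≡⟨ cong₂ _+_ (trans (cong (_* f i) (I-diag i)) (*-identityˡ (f i))) (sum-cong-≗ off-diagonal) ⟩
    f i + sum {n} (λ _ → 0ℚ)
      ≡⟨ trans (cong (f i +_) (sum-replicate-zero n)) (+-identityʳ (f i)) ⟩
    f i ∎
    where
    open ≡-Reasoning
    off-diagonal : ∀ l → I i (Fin.punchIn i l) * f (Fin.punchIn i l) ≡ 0ℚ
    off-diagonal l = trans (cong (_* f (Fin.punchIn i l)) (I-≢ (λ i≡ → punchInᵢ≢i i l (sym i≡)))) (*-zeroˡ (f (Fin.punchIn i l)))

  0ᴹ : ∀ {n} → Mat n
  0ᴹ _ _ = 0ℚ

  ≋-setoid : ℕ → Setoid 0ℓ 0ℓ
  ≋-setoid n = record
    { Carrier       = Mat n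
    ; _≈_           = _≋_
    ; isEquivalence = record
      { refl  = λ _ _ → refl
      ; sym   = λ M≋N i j → sym (M≋N i j)
      ; trans = λ L≋M M≋N i j → trans (L≋M i j) (M≋N i j)
      }
    }

  module ≋-Reasoning (n : ℕ) = Relation.Binary.Reasoning.Setoid (≋-setoid n)

  ⊗-cong : ∀ {n} {M M′ N N′ : Mat n} → M ≋ M′ → N ≋ N′ → (M ⊗ N) ≋ (M′ ⊗ N′)
  ⊗-cong M≋M′ N≋N′ i j = sumFin-cong (λ l → cong₂ _*_ (M≋M′ i l) (N≋N′ l j))

  ⊗-congˡ : ∀ {n} {M M′ : Mat n} (N : Mat n) → M ≋ M′ → (M ⊗ N) ≋ (M′ ⊗ N)
  ⊗-congˡ N M≋M′ = ⊗-cong M≋M′ (λ _ _ → refl)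

  ⊗-congʳ : ∀ {n} (M : Mat n) {N N′ : Mat n} → N ≋ N′ → (M ⊗ N) ≋ (M ⊗ N′)
  ⊗-congʳ M N≋N′ = ⊗-cong {M = M} (λ _ _ → refl) N≋N′

  ⊗-identityˡ : ∀ {n} (M : Mat n) → (I ⊗ M) ≋ M
  ⊗-identityˡ M i j = sumFin-δ i (λ l → M l j)

  ⊗-identityʳ : ∀ {n} (M : Mat n) → (M ⊗ I) ≋ M
  ⊗-identityʳ M i j = trans (sumFin-cong (λ l → trans (*-comm (M i l) (I l j)) (cong (_* M i l) (I-sym l j))))
                            (sumFin-δ j (M i))

  ⊗-zeroʳ : ∀ {n} (M : Mat n) → (M ⊗ 0ᴹ) ≋ 0ᴹ
  ⊗-zeroʳ {n} M i j = trans (sumFin-cong (λ l → *-zeroʳ (M i l))) (sumFin-zero {n})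

  ⊗-assoc : ∀ {n} (L M N : Mat n) → ((L ⊗ M) ⊗ N) ≋ (L ⊗ (M ⊗ N))
  ⊗-assoc L M N i j = begin
    sumFin (λ l → sumFin (λ m → L i m * M m l) * N l j)   ≡⟨ sumFin-cong (λ l → sym (sumFin-*ʳ (N l j) (λ m → L i m * M m l))) ⟩
    sumFin (λ l → sumFin (λ m → L i m * M m l * N l j))   ≡⟨ sumFin-comm (λ l m → L i m * M m l * N l j) ⟩
    sumFin (λ m → sumFin (λ l → L i m * M m l * N l j))   ≡⟨ sumFin-cong (λ m → sumFin-cong (λ l → *-assoc (L i m) (M m l) (N l j))) ⟩
    sumFin (λ m → sumFin (λ l → L i m * (M m l * N l j))) ≡⟨ sumFin-cong (λ m → sumFin-*ˡ (L i m) (λ l → M m l * N l j)) ⟩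
    sumFin (λ m → L i m * sumFin (λ l → M m l * N l j))   ∎
    where open ≡-Reasoning

  ⊗J≡rowSum : ∀ {n} (M : Mat n) i j → (M ⊗ J) i j ≡ sumFin (M i)
  ⊗J≡rowSum M i j = sumFin-cong (λ l → *-identityʳ (M i l))

  ⊗-linearˡ : ∀ {n} x y z (L M N P : Mat n) →
    ((λ i j → x * L i j + y * M i j + z * N i j) ⊗ P) ≋ (λ i j → x * (L ⊗ P) i j + y * (M ⊗ P) i j + z * (N ⊗ P) i j)
  ⊗-linearˡ x y z L M N P i j = trans (sumFin-cong (λ l → distribute x y z (L i l) (M i l) (N i l) (P l j)))
    (sumFin-linear₃ x y z (λ l → L i l * P l j) (λ l → M i l * P l j) (λ l → N i l * P l j))
    where
    distribute : ∀ x y z a b c d → (x * a + y * b + z * c) * d ≡ x * (a * d) + y * (b * d) + z * (c * d)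
    distribute = solve-∀ ℚ-ring

  ⊗-linearʳ : ∀ {n} x y z (P L M N : Mat n) →
    (P ⊗ (λ i j → x * L i j + y * M i j + z * N i j)) ≋ (λ i j → x * (P ⊗ L) i j + y * (P ⊗ M) i j + z * (P ⊗ N) i j)
  ⊗-linearʳ x y z P L M N i j = trans (sumFin-cong (λ l → distribute x y z (P i l) (L l j) (M l j) (N l j)))
    (sumFin-linear₃ x y z (λ l → P i l * L l j) (λ l → P i l * M l j) (λ l → P i l * N l j))
    where
    distribute : ∀ x y z d a b c → d * (x * a + y * b + z * c) ≡ x * (d * a) + y * (d * b) + z * (d * c)
    distribute = solve-∀ ℚ-ring

  ⊗≋I⇒⊗≋0ᴹ⇒≋0ᴹ : ∀ {n} {Y M N : Mat n} → (Y ⊗ M) ≋ I → (M ⊗ N) ≋ 0ᴹ → N ≋ 0ᴹ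
  ⊗≋I⇒⊗≋0ᴹ⇒≋0ᴹ {n} {Y} {M} {N} Y⊗M≋I M⊗N≋0 = begin
    N              ≈⟨ ⊗-identityˡ N ⟨
    I ⊗ N          ≈⟨ ⊗-congˡ N Y⊗M≋I ⟨
    (Y ⊗ M) ⊗ N    ≈⟨ ⊗-assoc Y M N ⟩
    Y ⊗ (M ⊗ N)    ≈⟨ ⊗-congʳ Y M⊗N≋0 ⟩
    Y ⊗ 0ᴹ         ≈⟨ ⊗-zeroʳ Y ⟩
    0ᴹ             ∎
    where open ≋-Reasoning n

module StronglyRegularGraph {n : ℕ} (G : Graph n) {k a c : ℕ} (srg : IsStronglyRegular G k a c) where

  open import Data.Nat using (zero; suc; s≤s; z≤n)
  import Data.Nat as ℕ
  import Data.Nat.Properties as ℕ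
  open import Data.Bool using (Bool; true; not; _∧_)
  import Data.Bool as Bool
  open import Data.Bool.Properties using (∧-idem; ¬-not)
  open import Data.Empty using (⊥)
  open import Data.Product using (proj₁)
  open import Data.Sum using (_⊎_; inj₁; inj₂)
  open import Relation.Nullary using (does)
  open import Relation.Nullary.Decidable using (dec-true; dec-false)
  open import Data.Rational using (ℚ; 0ℚ; 1ℚ; _+_; _*_; _-_; -_; 1/_; NonZero; ≢-nonZero)
  open import Data.Rational.Properties using (+-0-group; *-identityˡ; *-identityʳ; *-zeroʳ; *-inverseʳ; +-inverseʳ)
  open import Algebra.Properties.Group +-0-group using (x∙y⁻¹≈ε⇒x≈y; x≈y⇒x∙y⁻¹≈ε)
  open import Tactic.RingSolver using (solve-∀)
  open RationalArithmetic
  open FiniteSums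
  open Matrices
  open IsStronglyRegular srg

  A : Mat n
  A = adjMatrix G

  k′ a′ c′ n′ : ℚ
  k′ = fromℕ k
  a′ = fromℕ a
  c′ = fromℕ c
  n′ = fromℕ n

  _I+_A+_J : ℚ → ℚ → ℚ → Mat n
  (p I+ q A+ r J) i j = p * I i j + q * A i j + r * J i j

  Adj? : ∀ u v → Dec (Adj G u v)
  Adj? u v = adj G u v Bool.≟ true

  Adj⇒≢ : ∀ {u v} → Adj G u v → u ≢ v
  Adj⇒≢ {u} uv refl with () ← trans (sym (irref G u)) uv

  A-sym : ∀ i j → A i j ≡ A j i
  A-sym i j = cong indicator (Graph.sym G i j)

  I+A+J-sym : ∀ p q r i j → (p I+ q A+ r J) i j ≡ (p I+ q A+ r J) j i
  I+A+J-sym p q r i j = cong₂ (λ e α → p * e + q * α + r * 1ℚ) (I-sym i j) (A-sym i j)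

  I+A+J-cong : ∀ {p p₂ q q₂ r r₂} → p ≡ p₂ → q ≡ q₂ → r ≡ r₂ → (p I+ q A+ r J) ≋ (p₂ I+ q₂ A+ r₂ J)
  I+A+J-cong refl refl refl _ _ = refl

  I+A+J-diag : ∀ p q r u → (p I+ q A+ r J) u u ≡ p + r
  I+A+J-diag p q r u = trans (cong₂ (λ e α → p * e + q * α + r * 1ℚ) (I-diag u) (cong indicator (irref G u))) (entry p q r)
    where
    entry : ∀ p q r → p * 1ℚ + q * 0ℚ + r * 1ℚ ≡ p + r
    entry = solve-∀ ℚ-ring

  I+A+J-adjacent : ∀ p q r {u v} → Adj G u v → (p I+ q A+ r J) u v ≡ q + r
  I+A+J-adjacent p q r uv = trans (cong₂ (λ e α → p * e + q * α + r * 1ℚ) (I-≢ (Adj⇒≢ uv)) (cong indicator uv)) (entry p q r)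
    where
    entry : ∀ p q r → p * 0ℚ + q * 1ℚ + r * 1ℚ ≡ q + r
    entry = solve-∀ ℚ-ring

  I+A+J-nonadjacent : ∀ p q r {u v} → u ≢ v → ¬ Adj G u v → (p I+ q A+ r J) u v ≡ r
  I+A+J-nonadjacent p q r u≢v ¬uv =
    trans (cong₂ (λ e α → p * e + q * α + r * 1ℚ) (I-≢ u≢v) (cong indicator (¬-not ¬uv))) (entry p q r)
    where
    entry : ∀ p q r → p * 0ℚ + q * 0ℚ + r * 1ℚ ≡ r
    entry = solve-∀ ℚ-ring

  ≋-I+A+J : ∀ {M : Mat n} p q r →
            (∀ u → M u u ≡ p + r) →
            (∀ {u v} → Adj G u v → M u v ≡ q + r) →
            (∀ {u v} → u ≢ v → ¬ Adj G u v → M u v ≡ r) →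
            M ≋ (p I+ q A+ r J)
  ≋-I+A+J {M} p q r diag adjacent nonadjacent u v = by-cases (u Fin.≟ v) (Adj? u v)
    where
    by-cases : Dec (u ≡ v) → Dec (Adj G u v) → M u v ≡ (p I+ q A+ r J) u v
    by-cases (yes refl) _        = trans (diag u) (sym (I+A+J-diag p q r u))
    by-cases (no u≢v)   (yes uv) = trans (adjacent uv) (sym (I+A+J-adjacent p q r uv))
    by-cases (no u≢v)   (no ¬uv) = trans (nonadjacent u≢v ¬uv) (sym (I+A+J-nonadjacent p q r u≢v ¬uv))

  A-rowSum : ∀ u → sumFin (A u) ≡ k′
  A-rowSum u = trans (sumFin-indicator (adj G u)) (cong fromℕ (regular u))

  A⊗J : ∀ i j → (A ⊗ J) i j ≡ k′
  A⊗J i j = trans (⊗J≡rowSum A i j) (A-rowSum i)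

  J⊗A : ∀ i j → (J ⊗ A) i j ≡ k′
  J⊗A i j = trans (sumFin-cong (λ l → trans (*-identityˡ (A l j)) (A-sym l j))) (A-rowSum j)

  J⊗J : ∀ i j → (J ⊗ J) i j ≡ n′
  J⊗J i j = trans (⊗J≡rowSum (J {n}) i j) (sumFin-one {n})

  A⊗A≡commonNeighbours : ∀ u v → (A ⊗ A) u v ≡ fromℕ (commonNeighbours G u v)
  A⊗A≡commonNeighbours u v = trans
    (sumFin-cong (λ w → trans (cong (A u w *_) (A-sym w v)) (sym (indicator-∧ (adj G u w) (adj G v w)))))
    (sumFin-indicator (λ w → adj G u w ∧ adj G v w))

  A⊗A : (A ⊗ A) ≋ ((k′ - c′) I+ (a′ - c′) A+ c′ J)
  A⊗A = ≋-I+A+J (k′ - c′) (a′ - c′) c′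
    (λ u → trans (A⊗A≡commonNeighbours u u) (trans (cong fromℕ (degree≡ u)) (m≡m-c+c k′ c′)))
    (λ {u} {v} uv → trans (A⊗A≡commonNeighbours u v) (trans (cong fromℕ (adjCommon u v uv)) (m≡m-c+c a′ c′)))
    (λ {u} {v} u≢v ¬uv → trans (A⊗A≡commonNeighbours u v) (cong fromℕ (nonAdjCommon u v u≢v ¬uv)))
    where
    degree≡ : ∀ u → commonNeighbours G u u ≡ k
    degree≡ u = trans (count-cong (λ w → ∧-idem (adj G u w))) (regular u)
    m≡m-c+c : ∀ m c → m ≡ (m - c) + c
    m≡m-c+c = solve-∀ ℚ-ring

  A⊗I+A+J : ∀ p q r → (A ⊗ (p I+ q A+ r J)) ≋ (((k′ - c′) * q) I+ (p + (a′ - c′) * q) A+ (c′ * q + k′ * r) J)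
  A⊗I+A+J p q r i j = begin
    (A ⊗ (p I+ q A+ r J)) i j                              ≡⟨ ⊗-linearʳ p q r A I A J i j ⟩
    p * (A ⊗ I) i j + q * (A ⊗ A) i j + r * (A ⊗ J) i j   ≡⟨ linear-cong p q r (⊗-identityʳ A i j) (A⊗A i j) (A⊗J i j) ⟩
    p * A i j + q * ((k′ - c′) I+ (a′ - c′) A+ c′ J) i j + r * k′
                                                           ≡⟨ collect p q r k′ a′ c′ (I i j) (A i j) ⟩
    (((k′ - c′) * q) I+ (p + (a′ - c′) * q) A+ (c′ * q + k′ * r) J) i j ∎
    where
    open ≡-Reasoning
    collect : ∀ p q r k a c e α →
      p * α + q * ((k - c) * e + (a - c) * α + c * 1ℚ) + r * k ≡ (k - c) * q * e + (p + (a - c) * q) * α + (c * q + k * r) * 1ℚ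
    collect = solve-∀ ℚ-ring

  J⊗I+A+J : ∀ p q r i j → (J ⊗ (p I+ q A+ r J)) i j ≡ p + k′ * q + n′ * r
  J⊗I+A+J p q r i j = begin
    (J ⊗ (p I+ q A+ r J)) i j                              ≡⟨ ⊗-linearʳ p q r J I A J i j ⟩
    p * (J ⊗ I) i j + q * (J ⊗ A) i j + r * (J ⊗ J) i j   ≡⟨ linear-cong p q r (⊗-identityʳ J i j) (J⊗A i j) (J⊗J i j) ⟩
    p * 1ℚ + q * k′ + r * n′                               ≡⟨ collect p q r k′ n′ ⟩
    p + k′ * q + n′ * r                                    ∎
    where
    open ≡-Reasoning
    collect : ∀ p q r k n → p * 1ℚ + q * k + r * n ≡ p + k * q + n * r
    collect = solve-∀ ℚ-ring

  I+A+J-rowSum : ∀ p q r u → sumFin ((p I+ q A+ r J) u) ≡ p + k′ * q + n′ * r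
  I+A+J-rowSum p q r u = trans
    (sumFin-cong (λ l → trans (I+A+J-sym p q r u l) (sym (*-identityˡ _))))
    (J⊗I+A+J p q r u u)

  ⊗-I+A+J : ∀ p q r p′ q′ r′ →
    ((p I+ q A+ r J) ⊗ (p′ I+ q′ A+ r′ J)) ≋
    ((p * p′ + (k′ - c′) * q * q′) I+ (p * q′ + q * p′ + (a′ - c′) * q * q′) A+
     (p * r′ + r * p′ + k′ * (q * r′ + r * q′) + n′ * r * r′ + c′ * q * q′) J)
  ⊗-I+A+J p q r p′ q′ r′ i j = begin
    ((p I+ q A+ r J) ⊗ X′) i j                             ≡⟨ ⊗-linearˡ p q r I A J X′ i j ⟩
    p * (I ⊗ X′) i j + q * (A ⊗ X′) i j + r * (J ⊗ X′) i j
      ≡⟨ linear-cong p q r (⊗-identityˡ X′ i j) (A⊗I+A+J p′ q′ r′ i j) (J⊗I+A+J p′ q′ r′ i j) ⟩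
    p * X′ i j + q * (((k′ - c′) * q′) I+ (p′ + (a′ - c′) * q′) A+ (c′ * q′ + k′ * r′) J) i j + r * (p′ + k′ * q′ + n′ * r′)
      ≡⟨ collect p q r p′ q′ r′ k′ a′ c′ n′ (I i j) (A i j) ⟩
    _ ∎
    where
    open ≡-Reasoning
    X′ = p′ I+ q′ A+ r′ J
    collect : ∀ p q r p′ q′ r′ k a c n e α →
      p * (p′ * e + q′ * α + r′ * 1ℚ) + q * ((k - c) * q′ * e + (p′ + (a - c) * q′) * α + (c * q′ + k * r′) * 1ℚ)
        + r * (p′ + k * q′ + n * r′)
      ≡ (p * p′ + (k - c) * q * q′) * e + (p * q′ + q * p′ + (a - c) * q * q′) * α
        + (p * r′ + r * p′ + k * (q * r′ + r * q′) + n * r * r′ + c * q * q′) * 1ℚ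
    collect = solve-∀ ℚ-ring

  ⊗-comm-I+A+J : ∀ p q r p′ q′ r′ → ((p I+ q A+ r J) ⊗ (p′ I+ q′ A+ r′ J)) ≋ ((p′ I+ q′ A+ r′ J) ⊗ (p I+ q A+ r J))
  ⊗-comm-I+A+J p q r p′ q′ r′ = begin
    (p I+ q A+ r J) ⊗ (p′ I+ q′ A+ r′ J)  ≈⟨ ⊗-I+A+J p q r p′ q′ r′ ⟩
    _                                    ≈⟨ I+A+J-cong (swap₁ p q p′ q′ k′ c′) (swap₂ p q p′ q′ a′ c′) (swap₃ p q r p′ q′ r′ k′ n′ c′) ⟩
    _                                    ≈⟨ ⊗-I+A+J p′ q′ r′ p q r ⟨
    (p′ I+ q′ A+ r′ J) ⊗ (p I+ q A+ r J)  ∎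
    where
    open ≋-Reasoning n
    swap₁ : ∀ p q p′ q′ k c → p * p′ + (k - c) * q * q′ ≡ p′ * p + (k - c) * q′ * q
    swap₁ = solve-∀ ℚ-ring
    swap₂ : ∀ p q p′ q′ a c → p * q′ + q * p′ + (a - c) * q * q′ ≡ p′ * q + q′ * p + (a - c) * q′ * q
    swap₂ = solve-∀ ℚ-ring
    swap₃ : ∀ p q r p′ q′ r′ k n c →
      p * r′ + r * p′ + k * (q * r′ + r * q′) + n * r * r′ + c * q * q′ ≡ p′ * r + r′ * p + k * (q′ * r + r′ * q) + n * r′ * r + c * q′ * q
    swap₃ = solve-∀ ℚ-ring

  -- Both sides count the walks of length two starting at a vertex.
  k[k-a-1]≡c[n-k-1] : k′ * (k′ - a′ - 1ℚ) ≡ c′ * (n′ - k′ - 1ℚ)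
  k[k-a-1]≡c[n-k-1] with notEmpty
  ... | u , _ = begin
    k′ * (k′ - a′ - 1ℚ)                                ≡⟨ expand k′ a′ ⟩
    k′ * k′ - k′ * a′ - k′                              ≡⟨ cong (λ x → x - k′ * a′ - k′) k²≡ ⟩
    (k′ - c′) + k′ * (a′ - c′) + n′ * c′ - k′ * a′ - k′  ≡⟨ simplify k′ a′ c′ n′ ⟩
    c′ * (n′ - k′ - 1ℚ)                                ∎
    where
    open ≡-Reasoning
    k²≡ : k′ * k′ ≡ (k′ - c′) + k′ * (a′ - c′) + n′ * c′
    k²≡ = begin
      k′ * k′                              ≡⟨ cong (_* k′) (A-rowSum u) ⟨
      sumFin (A u) * k′                    ≡⟨ sumFin-*ʳ k′ (A u) ⟨
      sumFin (λ l → A u l * k′)            ≡⟨ sumFin-cong (λ l → cong (A u l *_) (A⊗J l u)) ⟨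
      (A ⊗ (A ⊗ J)) u u                    ≡⟨ ⊗-assoc A A J u u ⟨
      ((A ⊗ A) ⊗ J) u u                    ≡⟨ ⊗J≡rowSum (A ⊗ A) u u ⟩
      sumFin ((A ⊗ A) u)                   ≡⟨ sumFin-cong (A⊗A u) ⟩
      sumFin (((k′ - c′) I+ (a′ - c′) A+ c′ J) u) ≡⟨ I+A+J-rowSum (k′ - c′) (a′ - c′) c′ u ⟩
      (k′ - c′) + k′ * (a′ - c′) + n′ * c′ ∎
    expand : ∀ k a → k * (k - a - 1ℚ) ≡ k * k - k * a - k
    expand = solve-∀ ℚ-ring
    simplify : ∀ k a c n → (k - c) + k * (a - c) + n * c - k * a - k ≡ c * (n - k - 1ℚ)
    simplify = solve-∀ ℚ-ring

  nonNeighbour : Fin n → Fin n → Bool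
  nonNeighbour u v = not (does (u Fin.≟ v)) ∧ not (adj G u v)

  nonNeighbour≋ : (λ u v → indicator (nonNeighbour u v)) ≋ ((- 1ℚ) I+ (- 1ℚ) A+ 1ℚ J)
  nonNeighbour≋ = ≋-I+A+J (- 1ℚ) (- 1ℚ) 1ℚ
    (λ u → cong (λ b → indicator (not b ∧ not (adj G u u))) (dec-true (u Fin.≟ u) refl))
    (λ {u} {v} uv → cong₂ (λ b b′ → indicator (not b ∧ not b′)) (dec-false (u Fin.≟ v) (Adj⇒≢ uv)) uv)
    (λ {u} {v} u≢v ¬uv → cong₂ (λ b b′ → indicator (not b ∧ not b′)) (dec-false (u Fin.≟ v) u≢v) (¬-not ¬uv))

  nonNeighbour-count : ∀ u → fromℕ (count (nonNeighbour u)) ≡ n′ - 1ℚ - k′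
  nonNeighbour-count u = begin
    fromℕ (count (nonNeighbour u))                    ≡⟨ sumFin-indicator (nonNeighbour u) ⟨
    sumFin (λ v → indicator (nonNeighbour u v))       ≡⟨ sumFin-cong (nonNeighbour≋ u) ⟩
    sumFin (((- 1ℚ) I+ (- 1ℚ) A+ 1ℚ J) u)             ≡⟨ I+A+J-rowSum (- 1ℚ) (- 1ℚ) 1ℚ u ⟩
    - 1ℚ + k′ * - 1ℚ + n′ * 1ℚ                         ≡⟨ simplify k′ n′ ⟩
    n′ - 1ℚ - k′                                       ∎
    where
    open ≡-Reasoning
    simplify : ∀ k n → - 1ℚ + k * - 1ℚ + n * 1ℚ ≡ n - 1ℚ - k
    simplify = solve-∀ ℚ-ring

  ν : ℚ
  ν = fromℕ 2 * n′ - fromℕ 2 - k′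

  -- ν = k + 2m where m counts the non-neighbours of u, and a non-adjacent pair provides one.
  ν≢0 : ν ≢ 0ℚ
  ν≢0 ν≡0 with notComplete
  ... | u , v , u≢v , ¬uv = count≢0 (nonNeighbour u) {v} v-nonNeighbour (ℕ.m+n≡0⇒m≡0 m (ℕ.m+n≡0⇒n≡0 k (fromℕ-injective k+2m≡0)))
    where
    m = count (nonNeighbour u)
    v-nonNeighbour : nonNeighbour u v ≡ true
    v-nonNeighbour = cong₂ (λ b b′ → not b ∧ not b′) (dec-false (u Fin.≟ v) u≢v) (¬-not ¬uv)
    rearrange : ∀ k n → fromℕ 2 * n - fromℕ 2 - k ≡ k + fromℕ 2 * (n - 1ℚ - k)
    rearrange = solve-∀ ℚ-ring
    k+2m≡0 : fromℕ (k ℕ.+ 2 ℕ.* m) ≡ fromℕ 0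
    k+2m≡0 = begin
      fromℕ (k ℕ.+ 2 ℕ.* m)            ≡⟨ trans (fromℕ-+ k (2 ℕ.* m)) (cong (k′ +_) (fromℕ-* 2 m)) ⟩
      k′ + fromℕ 2 * fromℕ m           ≡⟨ cong (λ x → k′ + fromℕ 2 * x) (nonNeighbour-count u) ⟩
      k′ + fromℕ 2 * (n′ - 1ℚ - k′)    ≡⟨ rearrange k′ n′ ⟨
      ν                                ≡⟨ ν≡0 ⟩
      fromℕ 0                          ∎
      where open ≡-Reasoning

  ε : ℚ
  ε = fromℕ 2 * k′ + c′ - fromℕ 2 * a′ - fromℕ 2

  c′ν≡k′ε : c′ * ν ≡ k′ * ε
  c′ν≡k′ε = begin
    c′ * ν                                                      ≡⟨ expand₁ k′ c′ n′ ⟩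
    fromℕ 2 * (c′ * (n′ - k′ - 1ℚ)) + k′ * c′                   ≡⟨ cong (λ x → fromℕ 2 * x + k′ * c′) k[k-a-1]≡c[n-k-1] ⟨
    fromℕ 2 * (k′ * (k′ - a′ - 1ℚ)) + k′ * c′                   ≡⟨ expand₂ k′ a′ c′ ⟩
    k′ * ε                                                      ∎
    where
    open ≡-Reasoning
    expand₁ : ∀ k c n → c * (fromℕ 2 * n - fromℕ 2 - k) ≡ fromℕ 2 * (c * (n - k - 1ℚ)) + k * c
    expand₁ = solve-∀ ℚ-ring
    expand₂ : ∀ k a c → fromℕ 2 * (k * (k - a - 1ℚ)) + k * c ≡ k * (fromℕ 2 * k + c - fromℕ 2 * a - fromℕ 2)
    expand₂ = solve-∀ ℚ-ring

  k≢0 : k ≢ 0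
  k≢0 k≡0 with notEmpty
  ... | u , v , uv = count≢0 (adj G u) {v} uv (trans (regular u) k≡0)

  δ σ φ : ℚ
  δ = k′ + c′ - fromℕ 2 * a′ - fromℕ 4
  σ = fromℕ 2 + a′ - c′
  φ = fromℕ 2 * k′ + c′ - fromℕ 2 * a′ - fromℕ 4

  δ≡fromℕ[k+c]-fromℕ[2a+4] : δ ≡ fromℕ (k ℕ.+ c) - fromℕ (2 ℕ.* a ℕ.+ 4)
  δ≡fromℕ[k+c]-fromℕ[2a+4] = begin
    δ                                              ≡⟨ regroup k′ a′ c′ ⟩
    (k′ + c′) - (fromℕ 2 * a′ + fromℕ 4)           ≡⟨ cong₂ _-_ (fromℕ-+ k c) (trans (fromℕ-+ (2 ℕ.* a) 4) (cong (_+ fromℕ 4) (fromℕ-* 2 a))) ⟨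
    fromℕ (k ℕ.+ c) - fromℕ (2 ℕ.* a ℕ.+ 4)         ∎
    where
    open ≡-Reasoning
    regroup : ∀ k a c → k + c - fromℕ 2 * a - fromℕ 4 ≡ (k + c) - (fromℕ 2 * a + fromℕ 4)
    regroup = solve-∀ ℚ-ring

  δ≡0⇒k+c≡2a+4 : δ ≡ 0ℚ → k ℕ.+ c ≡ 2 ℕ.* a ℕ.+ 4
  δ≡0⇒k+c≡2a+4 δ≡0 = fromℕ-injective (x∙y⁻¹≈ε⇒x≈y _ _ (trans (sym δ≡fromℕ[k+c]-fromℕ[2a+4]) δ≡0))

  k+c≡2a+4⇒δ≡0 : k ℕ.+ c ≡ 2 ℕ.* a ℕ.+ 4 → δ ≡ 0ℚ
  k+c≡2a+4⇒δ≡0 k+c≡2a+4 = trans δ≡fromℕ[k+c]-fromℕ[2a+4] (x≈y⇒x∙y⁻¹≈ε (cong fromℕ k+c≡2a+4))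

  module Distance (D : Fin n → Fin n → ℕ) (dist : ∀ u v → IsDistance G u v (D u v)) where

    -- If c = 0, adjacency is transitive on distinct vertices, so no walk leaves the closed neighbourhood of its start.
    Walk⇒≡⊎Adj : c ≡ 0 → ∀ m {u v} → Walk G m u v → u ≡ v ⊎ Adj G u v
    Walk⇒≡⊎Adj c≡0 zero    u≡v              = inj₁ u≡v
    Walk⇒≡⊎Adj c≡0 (suc m) {u} {v} (w , uw , w⋯v) with Walk⇒≡⊎Adj c≡0 m w⋯v
    ... | inj₁ refl = inj₂ uw
    ... | inj₂ wv with u Fin.≟ v | Adj? u v
    ...   | yes u≡v | _        = inj₁ u≡v
    ...   | no _    | yes uv   = inj₂ uv
    ...   | no u≢v  | no ¬uv   = contradiction (trans (nonAdjCommon u v u≢v ¬uv) c≡0) (count≢0 _ {w} common)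
      where
      common : (adj G u w ∧ adj G v w) ≡ true
      common = cong₂ _∧_ uw (trans (Graph.sym G v w) wv)

    c≢0 : c ≢ 0
    c≢0 c≡0 with notComplete
    ... | u , v , u≢v , ¬uv with Walk⇒≡⊎Adj c≡0 (D u v) (proj₁ (dist u v))
    ...   | inj₁ u≡v = u≢v u≡v
    ...   | inj₂ uv  = ¬uv uv

    D-diag : ∀ u → D u u ≡ 0
    D-diag u with D u u | dist u u
    ... | zero  | _              = refl
    ... | suc _ | (_ , shortest) = contradiction refl (shortest 0 (s≤s z≤n))

    D-adjacent : ∀ {u v} → Adj G u v → D u v ≡ 1
    D-adjacent {u} {v} uv with D u v | dist u v
    ... | zero        | (u≡v , _)      = contradiction u≡v (Adj⇒≢ uv)
    ... | suc zero    | _              = refl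
    ... | suc (suc _) | (_ , shortest) = contradiction (v , uv , refl) (shortest 1 (s≤s (s≤s z≤n)))

    D-nonadjacent : ∀ {u v} → u ≢ v → ¬ Adj G u v → D u v ≡ 2
    D-nonadjacent {u} {v} u≢v ¬uv = at-most-2 (D u v) (dist u v)
      where
      walk₂ : Walk G 2 u v
      walk₂ with count≢0⇒∃ (λ w → adj G u w ∧ adj G v w) (c≢0 ∘ trans (sym (nonAdjCommon u v u≢v ¬uv)))
      ... | w , common with ∧≡true common
      ...   | uw , vw = w , uw , v , trans (Graph.sym G w v) vw , refl
      at-most-2 : ∀ d → IsDistance G u v d → d ≡ 2
      at-most-2 zero                (u≡v , _)              = contradiction u≡v u≢v
      at-most-2 (suc zero)          ((_ , uw , refl) , _)  = contradiction uw ¬uv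
      at-most-2 (suc (suc zero))    _                      = refl
      at-most-2 (suc (suc (suc _))) (_ , shortest)         = contradiction walk₂ (shortest 2 (s≤s (s≤s (s≤s z≤n))))

    D≋ : toℚMat D ≋ ((- fromℕ 2) I+ (- 1ℚ) A+ fromℕ 2 J)
    D≋ = ≋-I+A+J (- fromℕ 2) (- 1ℚ) (fromℕ 2)
      (λ u → cong fromℕ (D-diag u))
      (λ uv → cong fromℕ (D-adjacent uv))
      (λ u≢v ¬uv → cong fromℕ (D-nonadjacent u≢v ¬uv))

    ε≢0 : ε ≢ 0ℚ
    ε≢0 ε≡0 = *-≢0 (c≢0 ∘ fromℕ-injective) ν≢0 (trans c′ν≡k′ε (trans (cong (k′ *_) ε≡0) (*-zeroʳ k′)))

    module Inverse (δ≢0 : δ ≢ 0ℚ) where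

      kδε≢0 : k′ * δ * ε ≢ 0ℚ
      kδε≢0 = *-≢0 (*-≢0 (k≢0 ∘ fromℕ-injective) δ≢0) ε≢0

      instance
        δ-nonZero : NonZero δ
        δ-nonZero = ≢-nonZero δ≢0
        kδε-nonZero : NonZero (k′ * δ * ε)
        kδε-nonZero = ≢-nonZero kδε≢0

      ρ : ℚ
      ρ = c′ * φ * 1/ (k′ * δ * ε)

      claimedInverse≋ : claimedInverse G k a c ≋ ((σ * 1/ δ) I+ (- 1/ δ) A+ ρ J)
      claimedInverse≋ i j = trans (cong₂ _+_ (÷-≡-*1/ _ δ≢0) (cong (_* 1ℚ) (÷-≡-*1/ _ kδε≢0)))
                                  (regroup σ (I i j) (A i j) (1/ δ) (c′ * φ) (1/ (k′ * δ * ε)))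
        where
        regroup : ∀ s e α d x t → (s * e - α) * d + (x * t) * 1ℚ ≡ s * d * e + (- d) * α + x * t * 1ℚ
        regroup = solve-∀ ℚ-ring

      ρν≡φ/δ : ρ * ν ≡ φ * 1/ δ
      ρν≡φ/δ = begin
        ρ * ν                                   ≡⟨ regroup₁ c′ φ t ν ⟩
        φ * t * (c′ * ν)                        ≡⟨ cong (φ * t *_) c′ν≡k′ε ⟩
        φ * t * (k′ * ε)                        ≡⟨ *-identityʳ (φ * t * (k′ * ε)) ⟨
        φ * t * (k′ * ε) * 1ℚ                   ≡⟨ cong (φ * t * (k′ * ε) *_) (*-inverseʳ δ) ⟨
        φ * t * (k′ * ε) * (δ * 1/ δ)           ≡⟨ regroup₂ φ t k′ ε δ (1/ δ) ⟩
        φ * (k′ * δ * ε * t) * 1/ δ             ≡⟨ cong (λ x → φ * x * 1/ δ) (*-inverseʳ (k′ * δ * ε)) ⟩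
        φ * 1ℚ * 1/ δ                           ≡⟨ cong (_* 1/ δ) (*-identityʳ φ) ⟩
        φ * 1/ δ                                ∎
        where
        open ≡-Reasoning
        t = 1/ (k′ * δ * ε)
        regroup₁ : ∀ c φ t ν → c * φ * t * ν ≡ φ * t * (c * ν)
        regroup₁ = solve-∀ ℚ-ring
        regroup₂ : ∀ φ t k ε δ d → φ * t * (k * ε) * (δ * d) ≡ φ * (k * δ * ε * t) * d
        regroup₂ = solve-∀ ℚ-ring

      D⊗claimed≋I : (((- fromℕ 2) I+ (- 1ℚ) A+ fromℕ 2 J) ⊗ ((σ * 1/ δ) I+ (- 1/ δ) A+ ρ J)) ≋ I
      D⊗claimed≋I = begin
        _ ≈⟨ ⊗-I+A+J (- fromℕ 2) (- 1ℚ) (fromℕ 2) (σ * 1/ δ) (- 1/ δ) ρ ⟩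
        _ ≈⟨ I+A+J-cong P≡1 (Q≡0 k′ a′ c′ (1/ δ)) R≡0 ⟩
        1ℚ I+ 0ℚ A+ 0ℚ J ≈⟨ (λ i j → identity (I i j) (A i j)) ⟩
        I ∎
        where
        open ≋-Reasoning n
        d = 1/ δ
        P≡1 : - fromℕ 2 * (σ * d) + (k′ - c′) * - 1ℚ * - d ≡ 1ℚ
        P≡1 = trans (P≡δd k′ a′ c′ d) (*-inverseʳ δ)
          where
          P≡δd : ∀ k a c d → - fromℕ 2 * ((fromℕ 2 + a - c) * d) + (k - c) * - 1ℚ * - d ≡ (k + c - fromℕ 2 * a - fromℕ 4) * d
          P≡δd = solve-∀ ℚ-ring
        Q≡0 : ∀ k a c d → - fromℕ 2 * - d + - 1ℚ * ((fromℕ 2 + a - c) * d) + (a - c) * - 1ℚ * - d ≡ 0ℚ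
        Q≡0 = solve-∀ ℚ-ring
        R≡0 : - fromℕ 2 * ρ + fromℕ 2 * (σ * d) + k′ * (- 1ℚ * ρ + fromℕ 2 * - d) + n′ * fromℕ 2 * ρ + c′ * - 1ℚ * - d ≡ 0ℚ
        R≡0 = trans (R≡ρν-φd k′ a′ c′ n′ d ρ) (trans (cong (_- φ * d) ρν≡φ/δ) (+-inverseʳ (φ * d)))
          where
          R≡ρν-φd : ∀ k a c n d ρ →
            - fromℕ 2 * ρ + fromℕ 2 * ((fromℕ 2 + a - c) * d) + k * (- 1ℚ * ρ + fromℕ 2 * - d) + n * fromℕ 2 * ρ + c * - 1ℚ * - d
              ≡ ρ * (fromℕ 2 * n - fromℕ 2 - k) - (fromℕ 2 * k + c - fromℕ 2 * a - fromℕ 4) * d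
          R≡ρν-φd = solve-∀ ℚ-ring
        identity : ∀ e α → 1ℚ * e + 0ℚ * α + 0ℚ * 1ℚ ≡ e
        identity = solve-∀ ℚ-ring

      isInverse : IsInverse (toℚMat D) (claimedInverse G k a c)
      isInverse = D⊗Y≋I , Y⊗D≋I
        where
        open ≋-Reasoning n
        D⊗Y≋I : (toℚMat D ⊗ claimedInverse G k a c) ≋ I
        D⊗Y≋I = begin
          toℚMat D ⊗ claimedInverse G k a c  ≈⟨ ⊗-cong D≋ claimedInverse≋ ⟩
          _                                  ≈⟨ D⊗claimed≋I ⟩
          I                                  ∎
        Y⊗D≋I : (claimedInverse G k a c ⊗ toℚMat D) ≋ I
        Y⊗D≋I = begin
          claimedInverse G k a c ⊗ toℚMat D  ≈⟨ ⊗-cong claimedInverse≋ D≋ ⟩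
          _                                  ≈⟨ ⊗-comm-I+A+J (σ * 1/ δ) (- 1/ δ) ρ (- fromℕ 2) (- 1ℚ) (fromℕ 2) ⟩
          _                                  ≈⟨ D⊗claimed≋I ⟩
          I                                  ∎

    module Singular (δ≡0 : δ ≡ 0ℚ) where

      r₀ : ℚ
      r₀ = fromℕ 2 * σ + c′ - fromℕ 2 * k′

      M : Mat n
      M = (- σ * ν) I+ ν A+ r₀ J

      D⊗M≋0ᴹ : (toℚMat D ⊗ M) ≋ 0ᴹ
      D⊗M≋0ᴹ = begin
        toℚMat D ⊗ M      ≈⟨ ⊗-congˡ M D≋ ⟩
        _                 ≈⟨ ⊗-I+A+J (- fromℕ 2) (- 1ℚ) (fromℕ 2) (- σ * ν) ν r₀ ⟩
        _                 ≈⟨ I+A+J-cong P≡0 (Q≡0 k′ a′ c′ ν) (R≡0 k′ a′ c′ n′) ⟩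
        0ℚ I+ 0ℚ A+ 0ℚ J  ≈⟨ (λ i j → vanish (I i j) (A i j)) ⟩
        0ᴹ                ∎
        where
        open ≋-Reasoning n
        P≡0 : - fromℕ 2 * (- σ * ν) + (k′ - c′) * - 1ℚ * ν ≡ 0ℚ
        P≡0 = trans (P≡-νδ k′ a′ c′ ν) (trans (cong (λ x → - (ν * x)) δ≡0) (-[x*0]≡0 ν))
          where
          P≡-νδ : ∀ k a c ν → - fromℕ 2 * (- (fromℕ 2 + a - c) * ν) + (k - c) * - 1ℚ * ν ≡ - (ν * (k + c - fromℕ 2 * a - fromℕ 4))
          P≡-νδ = solve-∀ ℚ-ring
          -[x*0]≡0 : ∀ x → - (x * 0ℚ) ≡ 0ℚ
          -[x*0]≡0 = solve-∀ ℚ-ring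
        Q≡0 : ∀ k a c ν → - fromℕ 2 * ν + - 1ℚ * (- (fromℕ 2 + a - c) * ν) + (a - c) * - 1ℚ * ν ≡ 0ℚ
        Q≡0 = solve-∀ ℚ-ring
        R≡0 : ∀ k a c n →
          let σ = fromℕ 2 + a - c ; ν = fromℕ 2 * n - fromℕ 2 - k ; r₀ = fromℕ 2 * σ + c - fromℕ 2 * k in
          - fromℕ 2 * r₀ + fromℕ 2 * (- σ * ν) + k * (- 1ℚ * r₀ + fromℕ 2 * ν) + n * fromℕ 2 * r₀ + c * - 1ℚ * ν ≡ 0ℚ
        R≡0 = solve-∀ ℚ-ring
        vanish : ∀ e α → 0ℚ * e + 0ℚ * α + 0ℚ * 1ℚ ≡ 0ℚ
        vanish = solve-∀ ℚ-ring

      no-left-inverse : (Y : Mat n) → (Y ⊗ toℚMat D) ≋ I → ⊥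
      no-left-inverse Y Y⊗D≋I with notEmpty | notComplete
      ... | u , v , uv | x , y , x≢y , ¬xy = ν≢0 (begin
        ν                  ≡⟨ cancel ν r₀ ⟩
        (ν + r₀) - r₀      ≡⟨ cong₂ _-_ (I+A+J-adjacent (- σ * ν) ν r₀ uv) (I+A+J-nonadjacent (- σ * ν) ν r₀ x≢y ¬xy) ⟨
        M u v - M x y      ≡⟨ cong₂ _-_ (M≋0ᴹ u v) (M≋0ᴹ x y) ⟩
        0ℚ - 0ℚ            ≡⟨⟩
        0ℚ                 ∎)
        where
        open ≡-Reasoning
        M≋0ᴹ : M ≋ 0ᴹ
        M≋0ᴹ = ⊗≋I⇒⊗≋0ᴹ⇒≋0ᴹ {Y = Y} {toℚMat D} Y⊗D≋I D⊗M≋0ᴹ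
        cancel : ∀ x y → x ≡ (x + y) - y
        cancel = solve-∀ ℚ-ring

-- Opened only now: the modules above use the rational _+_ and _*_.
open import Data.Nat using (_+_; _*_)

theorem1 : ∀ {n : ℕ} (G : Graph n) (k a c : ℕ) → IsStronglyRegular G k a c →
           (D : Fin n → Fin n → ℕ) → (∀ u v → IsDistance G u v (D u v)) →
           (Invertible (toℚMat D) ⇔ (k + c ≢ 2 * a + 4))
           × (k + c ≢ 2 * a + 4 → IsInverse (toℚMat D) (claimedInverse G k a c))
theorem1 G k a c srg D dist = mk⇔ invertible⇒k+c≢2a+4 (λ k+c≢2a+4 → claimedInverse G k a c , inverse k+c≢2a+4) , inverse
  where
  open StronglyRegularGraph G srg
  open Distance D dist
  inverse : k + c ≢ 2 * a + 4 → IsInverse (toℚMat D) (claimedInverse G k a c)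
  inverse k+c≢2a+4 = Inverse.isInverse (k+c≢2a+4 ∘ δ≡0⇒k+c≡2a+4)
  invertible⇒k+c≢2a+4 : Invertible (toℚMat D) → k + c ≢ 2 * a + 4
  invertible⇒k+c≢2a+4 (Y , _ , Y⊗D≋I) k+c≡2a+4 = Singular.no-left-inverse (k+c≡2a+4⇒δ≡0 k+c≡2a+4) Y Y⊗D≋I
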